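{- Let $(D,X)$ be a dessin d'enfant with edge set $\mathcal E$ and monodromy pair $(\sigma_\circ,\sigma_\bullet)$, let $a,b\in\mathcal E$ be distinct, $t$ the transposition exchanging them, and $(D^t,X^t)$ a nondegenerate model for $(\sigma_\circ^t,\sigma_\bullet)$. Then $D^t$ is connected if and only if at least one of the following exists in the subgraph $D\setminus(a\cup b)$: a walk from $\circ_a$ to $\bullet_a$; a walk from $\circ_b$ to $\bullet_b$; a walk from $\circ_a$ to $\circ_b$; a walk from $\bullet_a$ to $\bullet_b$.
   Context: Permutations compose functionally, $\pi^s=s\pi s^{ -1}$. A bicolored graph is a finite multigraph with each vertex coloured white or black, every edge joining a white and a black vertex; for an edge $e$, $\circ_e$ and $\bullet_e$ denote its white and black vertex; it is nondegenerate if every vertex is incident to an edge. $D\setminus(a\cup b)$ denotes the graph with the same vertices as $D$ and all edges except $a$ and $b$. A dessin d'famille is a bicolored graph $G$ embedded in a connected oriented compact surface $X$ without boundary (no condition on the complement); its monodromy pair on its edge set: $\sigma_\circ$ (resp. $\sigma_\bullet$) sends each edge to the next edge around its white (resp. black) vertex in the cyclic order given by the orientation. A dessin d'enfant is a dessin d'famille with nondegenerate graph whose complement is a disjoint union of open discs. A model for a pair $(x,y)$ in $S_{\mathcal E}$ is a dessin d'famille with edge set $\mathcal E$ and monodromy pair $(x,y)$. -}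

module Defs where

open import Data.Nat using (ℕ)
open import Data.Nat.GeneralisedArithmetic using (iterate)
open import Data.Fin using (Fin)
open import Data.Fin.Permutation using (Permutation′; _⟨$⟩ʳ_; _∘ₚ_; flip; transpose)
open import Data.Product using (Σ; _×_)
open import Relation.Binary.PropositionalEquality using (_≡_; _≢_)
open import Data.Unit using (⊤)

-- The edge set is  Fin n ; a dessin (d'famille) with
-- nondegenerate graph is determined, as a bicoloured graph, by its
-- monodromy pair (σ∘ , σ•) : white vertices = cycles of σ∘, black
-- vertices = cycles of σ•, and edge e joins the σ∘-cycle of e to the
-- σ•-cycle of e.

-- conjugation with the paper's convention  π^s = s π s⁻¹  (functional composition)
-- (p ∘ₚ q applies p first, then q)
conj : ∀ {n} → Permutation′ n → Permutation′ n → Permutation′ n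
conj s π = flip s ∘ₚ π ∘ₚ s

SameCycle : ∀ {n} → Permutation′ n → Fin n → Fin n → Set
SameCycle σ e f = Σ ℕ (λ k → iterate (σ ⟨$⟩ʳ_) e k ≡ f)

data Colour : Set where
  white black : Colour

perm : ∀ {n} → Permutation′ n → Permutation′ n → Colour → Permutation′ n
perm σw σb white = σw
perm σw σb black = σb

opposite : Colour → Colour
opposite white = black
opposite black = white

-- a vertex of the (nondegenerate) graph of the pair (σw , σb) is named by a
-- colour and an edge incident to it; (c , e) denotes the c-coloured vertex of e
-- (so  (white , e) = ∘_e  and  (black , e) = •_e).
Vertex : ℕ → Set
Vertex n = Colour × Fin n

Incident : ∀ {n} → Permutation′ n → Permutation′ n → Colour → Fin n → Fin n → Set
Incident σw σb c r e = SameCycle (perm σw σb c) r e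

-- Walks in the subgraph with the same vertices and only the edges satisfying
-- the predicate  Allowed , from the c-vertex named r to the d-vertex named s.
data Walk {n} (σw σb : Permutation′ n) (Allowed : Fin n → Set)
     : Colour → Fin n → Colour → Fin n → Set where
  here : ∀ {c r s} → Incident σw σb c r s → Walk σw σb Allowed c r c s
  step : ∀ {c r d s} (e : Fin n) → Allowed e → Incident σw σb c r e →
         Walk σw σb Allowed (opposite c) e d s → Walk σw σb Allowed c r d s

AllEdges : ∀ {n} → Fin n → Set
AllEdges _ = ⊤

NotAB : ∀ {n} → Fin n → Fin n → Fin n → Set
NotAB a b e = (e ≢ a) × (e ≢ b)

Connected : ∀ {n} → Permutation′ n → Permutation′ n → Set
Connected σw σb = ∀ c r d s → Walk σw σb AllEdges c r d s

-- Let H = D ∖ (a ∪ b).  Conjugating σ∘ by t only renames white vertices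
-- (∘ₓ becomes the σ∘ᵗ-cycle of t x), so H sits unchanged inside Dᵗ, while the
-- edges are rewired: in Dᵗ the edge a joins ∘_b to •_a and b joins ∘_a to •_b.
--
-- If one of the four walks exists, it links the two rewired edges inside H;
-- since D is connected, every vertex reaches an endpoint of a or b inside H,
-- hence Dᵗ is connected.  Conversely, the set of vertices reachable in H from
-- ∘_a or •_b contains both endpoints of b in Dᵗ and is closed under the edges
-- of H, so a Dᵗ-walk from ∘_a to •_a must leave it along a; the endpoints ∘_b
-- and •_a of that crossing then give one of the four walks.
module Submission where

open import Defs
open import Data.Nat using (ℕ; zero; suc; _+_; _*_; _<_; z<s; s<s)
open import Data.Nat.Properties using (+-comm; *-comm; n<1+n)
open import Data.Nat.GeneralisedArithmetic using (iterate)
open import Data.Fin using (Fin; toℕ; _≟_)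
open import Data.Fin.Properties using (pigeonhole)
open import Data.Fin.Permutation
  using (Permutation′; transpose; _⟨$⟩ʳ_; _⟨$⟩ˡ_; inverseˡ; inverseʳ)
open import Data.Sum using (_⊎_; inj₁; inj₂; map)
open import Data.Product using (Σ; _,_)
open import Data.Unit using (tt)
open import Data.Empty using (⊥-elim)
open import Relation.Nullary using (yes; no)
open import Relation.Binary.PropositionalEquality
  using (_≡_; _≢_; refl; sym; trans; cong; subst; module ≡-Reasoning)
open import Function.Bundles using (_⇔_; mk⇔)

iterate-+ : ∀ {A : Set} (f : A → A) x m k →
            iterate f x (m + k) ≡ iterate f (iterate f x m) k
iterate-+ f x zero    k = refl
iterate-+ f x (suc m) k = iterate-+ f (f x) m k

iterate-*-period : ∀ {A : Set} (f : A → A) x p → iterate f x p ≡ x →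
                   ∀ k → iterate f x (k * p) ≡ x
iterate-*-period f x p fixed zero    = refl
iterate-*-period f x p fixed (suc k) = begin
  iterate f x (p + k * p)          ≡⟨ iterate-+ f x p (k * p) ⟩
  iterate f (iterate f x p) (k * p) ≡⟨ cong (λ y → iterate f y (k * p)) fixed ⟩
  iterate f x (k * p)              ≡⟨ iterate-*-period f x p fixed k ⟩
  x                                ∎
  where open ≡-Reasoning

<⇒+suc : ∀ {m k} → m < k → Σ ℕ (λ q → m + suc q ≡ k)
<⇒+suc {zero}  {suc q} z<s = q , refl
<⇒+suc {suc m} (s<s m<k) with q , eq ← <⇒+suc m<k = q , cong suc eq

module _ {n : ℕ} (σ : Permutation′ n) where

  private
    σ⁺ : Fin n → Fin n
    σ⁺ = σ ⟨$⟩ʳ_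

  iterate-injective : ∀ i x y → iterate σ⁺ x i ≡ iterate σ⁺ y i → x ≡ y
  iterate-injective zero    x y eq = eq
  iterate-injective (suc i) x y eq = begin
    x                  ≡⟨ inverseˡ σ ⟨
    σ ⟨$⟩ˡ (σ⁺ x)      ≡⟨ cong (σ ⟨$⟩ˡ_) (iterate-injective i (σ⁺ x) (σ⁺ y) eq) ⟩
    σ ⟨$⟩ˡ (σ⁺ y)      ≡⟨ inverseˡ σ ⟩
    y                  ∎
    where open ≡-Reasoning

  -- Two of the n + 1 values x, σ x, …, σⁿ x coincide, and σ is injective.
  iterate-periodic : ∀ x → Σ ℕ (λ q → iterate σ⁺ x (suc q) ≡ x)
  iterate-periodic x
    with i , j , i<j , eq ← pigeonhole (n<1+n n) (λ i → iterate σ⁺ x (toℕ i))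
    with q , i+q≡j ← <⇒+suc i<j
    = q , iterate-injective (toℕ i) _ _ (begin
        iterate σ⁺ (iterate σ⁺ x (suc q)) (toℕ i) ≡⟨ iterate-+ σ⁺ x (suc q) (toℕ i) ⟨
        iterate σ⁺ x (suc q + toℕ i)  ≡⟨ cong (iterate σ⁺ x) (+-comm (suc q) (toℕ i)) ⟩
        iterate σ⁺ x (toℕ i + suc q)  ≡⟨ cong (iterate σ⁺ x) i+q≡j ⟩
        iterate σ⁺ x (toℕ j)          ≡⟨ eq ⟨
        iterate σ⁺ x (toℕ i)          ∎)
    where open ≡-Reasoning

  SameCycle-refl : ∀ x → SameCycle σ x x
  SameCycle-refl x = 0 , refl

  SameCycle-trans : ∀ {x y z} → SameCycle σ x y → SameCycle σ y z → SameCycle σ x z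
  SameCycle-trans {x} (k , refl) (m , refl) = k + m , iterate-+ σ⁺ x k m

  SameCycle-sym : ∀ {x y} → SameCycle σ x y → SameCycle σ y x
  SameCycle-sym {x} (k , refl) with q , period ← iterate-periodic x =
    q * k , (begin
      iterate σ⁺ (iterate σ⁺ x k) (q * k) ≡⟨ iterate-+ σ⁺ x k (q * k) ⟨
      iterate σ⁺ x (suc q * k)             ≡⟨ cong (iterate σ⁺ x) (*-comm (suc q) k) ⟩
      iterate σ⁺ x (k * suc q)             ≡⟨ iterate-*-period σ⁺ x (suc q) period k ⟩
      x                                    ∎)
    where open ≡-Reasoning

iterate-conj : ∀ {n} (s π : Permutation′ n) x k →
  iterate (conj s π ⟨$⟩ʳ_) x k ≡ s ⟨$⟩ʳ iterate (π ⟨$⟩ʳ_) (s ⟨$⟩ˡ x) k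
iterate-conj s π x zero    = sym (inverseʳ s)
iterate-conj s π x (suc k) = trans (iterate-conj s π _ k)
  (cong (λ y → s ⟨$⟩ʳ iterate (π ⟨$⟩ʳ_) y k) (inverseˡ s))

SameCycle-conj⁺ : ∀ {n} (s π : Permutation′ n) {x y} →
  SameCycle π x y → SameCycle (conj s π) (s ⟨$⟩ʳ x) (s ⟨$⟩ʳ y)
SameCycle-conj⁺ s π (k , refl) = k , trans (iterate-conj s π _ k)
  (cong (λ y → s ⟨$⟩ʳ iterate (π ⟨$⟩ʳ_) y k) (inverseˡ s))

SameCycle-conj⁻ : ∀ {n} (s π : Permutation′ n) {x y} →
  SameCycle (conj s π) x y → SameCycle π (s ⟨$⟩ˡ x) (s ⟨$⟩ˡ y)
SameCycle-conj⁻ s π {x} (k , refl) =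
  k , sym (trans (cong (s ⟨$⟩ˡ_) (iterate-conj s π x k)) (inverseˡ s))

transpose-first : ∀ {n} (i j : Fin n) → transpose i j ⟨$⟩ʳ i ≡ j
transpose-first i j with i ≟ i
... | yes _  = refl
... | no i≢i = ⊥-elim (i≢i refl)

transpose-second : ∀ {n} (i j : Fin n) → i ≢ j → transpose i j ⟨$⟩ʳ j ≡ i
transpose-second i j i≢j with j ≟ i
... | yes j≡i = ⊥-elim (i≢j (sym j≡i))
... | no _ with j ≟ j
...   | yes _  = refl
...   | no j≢j = ⊥-elim (j≢j refl)

transpose-fixed : ∀ {n} (i j k : Fin n) → k ≢ i → k ≢ j → transpose i j ⟨$⟩ʳ k ≡ k
transpose-fixed i j k k≢i k≢j with k ≟ i
... | yes k≡i = ⊥-elim (k≢i k≡i)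
... | no _ with k ≟ j
...   | yes k≡j = ⊥-elim (k≢j k≡j)
...   | no _    = refl

⟨$⟩ʳ⇒⟨$⟩ˡ : ∀ {n} (s : Permutation′ n) {x y} → s ⟨$⟩ʳ x ≡ y → s ⟨$⟩ˡ y ≡ x
⟨$⟩ʳ⇒⟨$⟩ˡ s refl = inverseˡ s

module WalkOps {n} (σw σb : Permutation′ n) (Allowed : Fin n → Set) where

  private
    W = Walk σw σb Allowed
    I = Incident σw σb

  Incident-refl : ∀ {c r} → I c r r
  Incident-refl {c} {r} = SameCycle-refl (perm σw σb c) r

  Incident-trans : ∀ {c r s u} → I c r s → I c s u → I c r u
  Incident-trans {c} = SameCycle-trans (perm σw σb c)

  Incident-sym : ∀ {c r s} → I c r s → I c s r
  Incident-sym {c} = SameCycle-sym (perm σw σb c)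

  _◅_ : ∀ {c r s d u} → I c r s → W c s d u → W c r d u
  i ◅ here j         = here (Incident-trans i j)
  i ◅ step e ok j w  = step e ok (Incident-trans i j) w

  _++_ : ∀ {c r d s c′ u} → W c r d s → W d s c′ u → W c r c′ u
  here i        ++ w′ = i ◅ w′
  step e ok i w ++ w′ = step e ok i (w ++ w′)

  _▻_ : ∀ {c r d s u} → W c r d s → I d s u → W c r d u
  w ▻ i = w ++ here i

  edge : ∀ {c r} e → Allowed e → I c r e → W c r (opposite c) e
  edge e ok i = step e ok i (here Incident-refl)

  reverse : ∀ {c r d s} → W c r d s → W d s c r
  reverse (here i)                = here (Incident-sym i)
  reverse (step {white} e ok i w) = reverse w ++ step e ok Incident-refl (here (Incident-sym i))
  reverse (step {black} e ok i w) = reverse w ++ step e ok Incident-refl (here (Incident-sym i))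

Walk-weaken : ∀ {n} {σw σb : Permutation′ n} {A B : Fin n → Set} →
  (∀ {e} → A e → B e) → ∀ {c r d s} → Walk σw σb A c r d s → Walk σw σb B c r d s
Walk-weaken A⊆B (here i)        = here i
Walk-weaken A⊆B (step e ok i w) = step e (A⊆B ok) i (Walk-weaken A⊆B w)

-- In the pair (conj s σw , σb) the vertex ∘ₓ of (σw , σb) is named by s x.
relabel : ∀ {n} → Permutation′ n → Colour → Fin n → Fin n
relabel s white x = s ⟨$⟩ʳ x
relabel s black x = x

unrelabel : ∀ {n} → Permutation′ n → Colour → Fin n → Fin n
unrelabel s white x = s ⟨$⟩ˡ x
unrelabel s black x = x

module _ {n} (s : Permutation′ n) where

  relabel-unrelabel : ∀ c x → relabel s c (unrelabel s c x) ≡ x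
  relabel-unrelabel white x = inverseʳ s
  relabel-unrelabel black x = refl

  relabel-fixed : ∀ c {e} → s ⟨$⟩ʳ e ≡ e → relabel s c e ≡ e
  relabel-fixed white fixed = fixed
  relabel-fixed black fixed = refl

  unrelabel-fixed : ∀ c {e} → s ⟨$⟩ʳ e ≡ e → unrelabel s c e ≡ e
  unrelabel-fixed white fixed = ⟨$⟩ʳ⇒⟨$⟩ˡ s fixed
  unrelabel-fixed black fixed = refl

  module _ (σw σb : Permutation′ n) where

    Incident-conj⁺ : ∀ c {r e} → Incident σw σb c r e →
      Incident (conj s σw) σb c (relabel s c r) (relabel s c e)
    Incident-conj⁺ white i = SameCycle-conj⁺ s σw i
    Incident-conj⁺ black i = i

    Incident-conj⁻ : ∀ c {r e} → Incident (conj s σw) σb c r e →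
      Incident σw σb c (unrelabel s c r) (unrelabel s c e)
    Incident-conj⁻ white i = SameCycle-conj⁻ s σw i
    Incident-conj⁻ black i = i

    Walk-conj : ∀ {Allowed} → (∀ {e} → Allowed e → s ⟨$⟩ʳ e ≡ e) →
      ∀ {c r d u} → Walk σw σb Allowed c r d u →
      Walk (conj s σw) σb Allowed c (relabel s c r) d (relabel s d u)
    Walk-conj fixes {c} (here i) = here (Incident-conj⁺ c i)
    Walk-conj {Allowed} fixes {c} {r} {d} {u} (step e ok i w) =
      step e ok (subst (Incident (conj s σw) σb c (relabel s c r))
                       (relabel-fixed c (fixes ok)) (Incident-conj⁺ c i))
        (subst (λ x → Walk (conj s σw) σb Allowed (opposite c) x d (relabel s d u))
               (relabel-fixed (opposite c) (fixes ok)) (Walk-conj fixes w))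

module _ {n} {σw σb : Permutation′ n} {a b : Fin n} where

  EndpointWalk : Colour → Fin n → Fin n → Set
  EndpointWalk c r e = Σ Colour (λ c′ → Walk σw σb (NotAB a b) c r c′ e)

  avoid-or-reach-endpoint : ∀ {c r d u} → Walk σw σb AllEdges c r d u →
    Walk σw σb (NotAB a b) c r d u ⊎ (EndpointWalk c r a ⊎ EndpointWalk c r b)
  avoid-or-reach-endpoint (here i) = inj₁ (here i)
  avoid-or-reach-endpoint {c} (step e _ i w) with e ≟ a | e ≟ b
  ... | yes refl | _        = inj₂ (inj₁ (c , here i))
  ... | no _     | yes refl = inj₂ (inj₂ (c , here i))
  ... | no e≢a   | no e≢b   with avoid-or-reach-endpoint w
  ...   | inj₁ w′                = inj₁ (step e (e≢a , e≢b) i w′)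
  ...   | inj₂ (inj₁ (c′ , w′)) = inj₂ (inj₁ (c′ , step e (e≢a , e≢b) i w′))
  ...   | inj₂ (inj₂ (c′ , w′)) = inj₂ (inj₂ (c′ , step e (e≢a , e≢b) i w′))

module Transposition {n} (σw σb : Permutation′ n) (a b : Fin n) (a≢b : a ≢ b) where

  t : Permutation′ n
  t = transpose a b

  σt : Permutation′ n
  σt = conj t σw

  HWalk DᵗWalk : Colour → Fin n → Colour → Fin n → Set
  HWalk  = Walk σw σb (NotAB a b)
  DᵗWalk = Walk σt σb AllEdges

  module H = WalkOps σw σb (NotAB a b)
  module Dᵗ = WalkOps σt σb AllEdges

  Condition : Set
  Condition = HWalk white a black a
            ⊎ (HWalk white b black b
            ⊎ (HWalk white a white b
            ⊎ HWalk black a black b))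

  t-a : t ⟨$⟩ʳ a ≡ b
  t-a = transpose-first a b

  t-b : t ⟨$⟩ʳ b ≡ a
  t-b = transpose-second a b a≢b

  t⁻¹-a : t ⟨$⟩ˡ a ≡ b
  t⁻¹-a = ⟨$⟩ʳ⇒⟨$⟩ˡ t t-b

  t⁻¹-b : t ⟨$⟩ˡ b ≡ a
  t⁻¹-b = ⟨$⟩ʳ⇒⟨$⟩ˡ t t-a

  t-fixes-NotAB : ∀ {e} → NotAB a b e → t ⟨$⟩ʳ e ≡ e
  t-fixes-NotAB (e≢a , e≢b) = transpose-fixed a b _ e≢a e≢b

  lift : ∀ {c r d u} → HWalk c r d u →
    DᵗWalk c (relabel t c r) d (relabel t d u)
  lift w = Walk-weaken (λ _ → tt) (Walk-conj t σw σb t-fixes-NotAB w)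

  lift-unrelabel : ∀ {c r d u} → HWalk c (unrelabel t c r) d u →
    DᵗWalk c r d (relabel t d u)
  lift-unrelabel {c} {r} {d} {u} w =
    subst (λ x → DᵗWalk c x d (relabel t d u)) (relabel-unrelabel t c r) (lift w)

  edge-a : DᵗWalk white (t ⟨$⟩ʳ b) black a
  edge-a = Dᵗ.edge a tt (subst (λ x → Incident σt σb white x a) (sym t-b) Dᵗ.Incident-refl)

  edge-b : DᵗWalk white (t ⟨$⟩ʳ a) black b
  edge-b = Dᵗ.edge b tt (subst (λ x → Incident σt σb white x b) (sym t-a) Dᵗ.Incident-refl)

  bridge : Condition → DᵗWalk white (t ⟨$⟩ʳ b) white (t ⟨$⟩ʳ a)
  bridge (inj₁ w)               = edge-a Dᵗ.++ Dᵗ.reverse (lift w)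
  bridge (inj₂ (inj₁ w))        = lift w Dᵗ.++ Dᵗ.reverse edge-b
  bridge (inj₂ (inj₂ (inj₁ w))) = Dᵗ.reverse (lift w)
  bridge (inj₂ (inj₂ (inj₂ w))) = edge-a Dᵗ.++ (lift w Dᵗ.++ Dᵗ.reverse edge-b)

  endpoint-a-to-hub : Condition → ∀ c → DᵗWalk c (relabel t c a) white (t ⟨$⟩ʳ a)
  endpoint-a-to-hub g white = here Dᵗ.Incident-refl
  endpoint-a-to-hub g black = Dᵗ.reverse edge-a Dᵗ.++ bridge g

  endpoint-b-to-hub : Condition → ∀ c → DᵗWalk c (relabel t c b) white (t ⟨$⟩ʳ a)
  endpoint-b-to-hub g white = bridge g
  endpoint-b-to-hub g black = Dᵗ.reverse edge-b

  to-hub : Connected σw σb → Condition → ∀ c r → DᵗWalk c r white (t ⟨$⟩ʳ a)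
  to-hub connD g c r with avoid-or-reach-endpoint (connD c (unrelabel t c r) white a)
  ... | inj₁ w                = lift-unrelabel w
  ... | inj₂ (inj₁ (c′ , w)) = lift-unrelabel w Dᵗ.++ endpoint-a-to-hub g c′
  ... | inj₂ (inj₂ (c′ , w)) = lift-unrelabel w Dᵗ.++ endpoint-b-to-hub g c′

  connected-if : Connected σw σb → Condition → Connected σt σb
  connected-if connD g c r d u =
    to-hub connD g c r Dᵗ.++ Dᵗ.reverse (to-hub connD g d u)

  Reached : Colour → Fin n → Set
  Reached c r = HWalk white a c (unrelabel t c r)
              ⊎ HWalk black b c (unrelabel t c r)

  Reached-incident : ∀ {c r u} → Incident σt σb c r u → Reached c r → Reached c u
  Reached-incident {c} {r} {u} i = map (H._▻ i′) (H._▻ i′)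
    where
    i′ : Incident σw σb c (unrelabel t c r) (unrelabel t c u)
    i′ = Incident-conj⁻ t σw σb c i

  Reached-b : ∀ c → Reached c b
  Reached-b white = inj₁ (here (subst (Incident σw σb white a) (sym t⁻¹-b) H.Incident-refl))
  Reached-b black = inj₂ (here H.Incident-refl)

  Reached-step : ∀ {c r e} → e ≢ a → e ≢ b →
    Incident σt σb c r e → Reached c r → Reached (opposite c) e
  Reached-step {c} {r} {e} e≢a e≢b i = map extend extend
    where
    t-fixes-e : t ⟨$⟩ʳ e ≡ e
    t-fixes-e = t-fixes-NotAB (e≢a , e≢b)
    i′ : Incident σw σb c (unrelabel t c r) e
    i′ = subst (Incident σw σb c _) (unrelabel-fixed t c t-fixes-e) (Incident-conj⁻ t σw σb c i)
    extend : ∀ {x y} → HWalk x y c (unrelabel t c r) →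
      HWalk x y (opposite c) (unrelabel t (opposite c) e)
    extend w = subst (HWalk _ _ (opposite c)) (sym (unrelabel-fixed t (opposite c) t-fixes-e))
                     (w H.++ H.edge e (e≢a , e≢b) i′)

  white-end-of-a : ∀ {r} → Incident σt σb white r a →
    Incident σw σb white (t ⟨$⟩ˡ r) b
  white-end-of-a i = subst (Incident σw σb white _) t⁻¹-a (Incident-conj⁻ t σw σb white i)

  crossing-a : ∀ {c r} → Incident σt σb c r a → Reached c r → Condition
  crossing-a {white} i (inj₁ w) = inj₂ (inj₂ (inj₁ (w H.▻ white-end-of-a i)))
  crossing-a {white} i (inj₂ w) = inj₂ (inj₁ (H.reverse (w H.▻ white-end-of-a i)))
  crossing-a {black} i (inj₁ w) = inj₁ (w H.▻ i)
  crossing-a {black} i (inj₂ w) = inj₂ (inj₂ (inj₂ (H.reverse (w H.▻ i))))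

  propagate : ∀ {c r d u} → DᵗWalk c r d u → Reached c r → Reached d u ⊎ Condition
  propagate (here i) reached = inj₁ (Reached-incident i reached)
  propagate {c} (step e _ i w) reached with e ≟ a | e ≟ b
  ... | yes refl | _        = inj₂ (crossing-a i reached)
  ... | no _     | yes refl = propagate w (Reached-b (opposite c))
  ... | no e≢a   | no e≢b   = propagate w (Reached-step e≢a e≢b i reached)

  connected-only-if : Connected σt σb → Condition
  connected-only-if conn with propagate (conn white b black a) (Reached-b white)
  ... | inj₁ (inj₁ w) = inj₁ w
  ... | inj₁ (inj₂ w) = inj₂ (inj₂ (inj₂ (H.reverse w)))
  ... | inj₂ g        = g

mainTheorem9 : (n : ℕ) (σw σb : Permutation′ n) → Connected σw σb →
    (a b : Fin n) → a ≢ b →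
    Connected (conj (transpose a b) σw) σb ⇔
      (Walk σw σb (NotAB a b) white a black a
        ⊎ (Walk σw σb (NotAB a b) white b black b
        ⊎ (Walk σw σb (NotAB a b) white a white b
        ⊎ Walk σw σb (NotAB a b) black a black b)))
mainTheorem9 n σw σb connD a b a≢b = mk⇔ connected-only-if (connected-if connD)
  where open Transposition σw σb a b a≢b
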